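{- For every $n\in\mathbb{N}$, $$\sum_{k=0}^n(-q)^{n-k}S_B^o[n,k]=1.$$
   Context: $[m]=(1-q^m)/(1-q)$ and $[m]!!=[m][m-2][m-4]\cdots$ ending at $[1]$ or $[2]$, with $[0]!!=1$. Define $S_B[0,k]=\delta_{0,k}$ ($k\in\mathbb{Z}$), $S_B[n,k]=S_B[n-1,k-1]+[2k+1]S_B[n-1,k]$ for $n\ge1$, and $S_B^o[n,k]=[2k]!!\,S_B[n,k]$. -}

module Defs where

open import Level using (Level)
open import Data.Nat using (ℕ; zero; suc; _∸_)
import Data.Nat as N
open import Algebra.Bundles using (CommutativeRing)

-- All q-analogues live in an arbitrary commutative ring R at an arbitrary
-- element q; an identity holding for every (R , q) is the same as an
-- identity in ℤ[q] with q an indeterminate (take R = ℤ[q]).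
module QDefs {c ℓ : Level} (R : CommutativeRing c ℓ) (q : CommutativeRing.Carrier R) where
  open CommutativeRing R using (Carrier; _+_; _*_; -_; 0#; 1#)

  pow : Carrier → ℕ → Carrier
  pow x zero    = 1#
  pow x (suc m) = x * pow x m

  qnum : ℕ → Carrier
  qnum zero    = 0#
  qnum (suc m) = pow q m + qnum m

  qdfact : ℕ → Carrier
  qdfact zero          = 1#
  qdfact (suc zero)    = qnum 1
  qdfact (suc (suc m)) = qnum (suc (suc m)) * qdfact m

  -- S_B[n,k] for k ≥ 0 (S_B[n,k] = 0 for k < 0, so the k-1 term vanishes at k = 0)
  SB : ℕ → ℕ → Carrier
  SB zero    zero    = 1#
  SB zero    (suc k) = 0#
  SB (suc n) zero    = qnum 1 * SB n zero
  SB (suc n) (suc k) = SB n k + qnum (2 N.* suc k N.+ 1) * SB n (suc k)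

  SBo : ℕ → ℕ → Carrier
  SBo n k = qdfact (2 N.* k) * SB n k

  sumTo : ℕ → (ℕ → Carrier) → Carrier
  sumTo zero    f = f zero
  sumTo (suc n) f = sumTo n f + f (suc n)

  lhs : ℕ → Carrier
  lhs n = sumTo n (λ k → pow (- q) (n ∸ k) * SBo n k)

{-# OPTIONS --safe #-}

-- The sum is independent of n, and equals 1 at n = 0.  Expanding S_B[n+1,k]
-- by its recurrence splits the sum for n + 1 into a part shifted in k and a
-- part carrying [2k+1]; after reindexing, the k-th terms combine to
-- (-q)^(n-k) S_B[n,k] ([2k+2]!! - q [2k+1][2k]!!), and
-- [2k+2]!! = (1 + q[2k+1]) [2k]!! makes this the k-th term of the sum for n.
module Submission where

open import Defs
open import Algebra.Bundles using (CommutativeRing)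
open import Level using (Level)
import Data.Nat as N
open import Data.Nat using (ℕ; zero; suc; _∸_; z≤n; s≤s)
import Data.Nat.Properties as NP

module _ {c ℓ : Level} (R : CommutativeRing c ℓ) (q : CommutativeRing.Carrier R) where
  open CommutativeRing R hiding (zero)
  open QDefs R q
  open import Relation.Binary.Reasoning.Setoid setoid
  open import Algebra.Properties.CommutativeSemigroup +-commutativeSemigroup
    using (interchange; x∙yz≈y∙xz)
  open import Algebra.Solver.Ring.NaturalCoefficients.Default commutativeSemiring

  sumTo-cong : ∀ n {f g} → (∀ k → k N.≤ n → f k ≈ g k) → sumTo n f ≈ sumTo n g
  sumTo-cong zero    f≈g = f≈g zero z≤n
  sumTo-cong (suc n) f≈g =
    +-cong (sumTo-cong n (λ k k≤n → f≈g k (NP.m≤n⇒m≤1+n k≤n))) (f≈g (suc n) NP.≤-refl)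

  sumTo-+ : ∀ n f g → sumTo n (λ k → f k + g k) ≈ sumTo n f + sumTo n g
  sumTo-+ zero    f g = refl
  sumTo-+ (suc n) f g = begin
    sumTo n (λ k → f k + g k) + (f (suc n) + g (suc n)) ≈⟨ +-congʳ (sumTo-+ n f g) ⟩
    sumTo n f + sumTo n g + (f (suc n) + g (suc n))     ≈⟨ interchange _ _ _ _ ⟩
    sumTo n f + f (suc n) + (sumTo n g + g (suc n))     ∎

  sumTo-suc : ∀ n f → sumTo (suc n) f ≈ f zero + sumTo n (λ k → f (suc k))
  sumTo-suc zero    f = refl
  sumTo-suc (suc n) f = trans (+-congʳ (sumTo-suc n f)) (+-assoc _ _ _)

  sumTo-+-shift : ∀ n u v → u (suc n) ≈ 0# →
    u zero + sumTo n (λ k → v k + u (suc k)) ≈ sumTo n (λ k → v k + u k)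
  sumTo-+-shift n u v u[n+1]≈0 = begin
    u zero + sumTo n (λ k → v k + u (suc k))       ≈⟨ +-congˡ (sumTo-+ n v (λ k → u (suc k))) ⟩
    u zero + (sumTo n v + sumTo n (λ k → u (suc k))) ≈⟨ x∙yz≈y∙xz _ _ _ ⟩
    sumTo n v + (u zero + sumTo n (λ k → u (suc k))) ≈⟨ +-congˡ (sym (sumTo-suc n u)) ⟩
    sumTo n v + (sumTo n u + u (suc n))             ≈⟨ +-congˡ (trans (+-congˡ u[n+1]≈0) (+-identityʳ _)) ⟩
    sumTo n v + sumTo n u                           ≈⟨ sym (sumTo-+ n v u) ⟩
    sumTo n (λ k → v k + u k)                       ∎

  qnum-suc : ∀ m → qnum (suc m) ≈ 1# + q * qnum m
  qnum-suc zero    = +-congˡ (sym (zeroʳ q))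
  qnum-suc (suc m) = begin
    q * pow q m + qnum (suc m)      ≈⟨ +-congˡ (qnum-suc m) ⟩
    q * pow q m + (1# + q * qnum m) ≈⟨ solve 3 (λ x p r → x :* p :+ (con 1 :+ x :* r) := con 1 :+ x :* (p :+ r))
                                         refl q (pow q m) (qnum m) ⟩
    1# + q * (pow q m + qnum m)     ∎

  qdfact-double-suc : ∀ k → qdfact (2 N.* suc k) ≈ (1# + q * qnum (2 N.* k N.+ 1)) * qdfact (2 N.* k)
  qdfact-double-suc k rewrite NP.*-suc 2 k | NP.+-comm (2 N.* k) 1 = *-congʳ (qnum-suc (suc (2 N.* k)))

  SB-above-diagonal : ∀ {n k} → n N.< k → SB n k ≈ 0#
  SB-above-diagonal {zero}  {suc k} _         = refl
  SB-above-diagonal {suc n} {suc k} (s≤s n<k) = begin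
    SB n k + qnum (2 N.* suc k N.+ 1) * SB n (suc k) ≈⟨ +-cong (SB-above-diagonal n<k)
                                                          (*-congˡ (SB-above-diagonal (NP.m<n⇒m<1+n n<k))) ⟩
    0# + qnum (2 N.* suc k N.+ 1) * 0#              ≈⟨ trans (+-identityˡ _) (zeroʳ _) ⟩
    0#                                              ∎

  lhs-suc : ∀ n → lhs (suc n) ≈ lhs n
  lhs-suc n = begin
    lhs (suc n)                                      ≈⟨ sumTo-suc n (term (suc n)) ⟩
    term (suc n) zero + sumTo n (λ k → term (suc n) (suc k))
                                                     ≈⟨ +-congˡ (sumTo-cong n (λ k _ → term-suc k)) ⟩
    u zero + sumTo n (λ k → v k + u (suc k))         ≈⟨ sumTo-+-shift n u v u[n+1]≈0 ⟩
    sumTo n (λ k → v k + u k)                        ≈⟨ sumTo-cong n v+u≈term ⟩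
    lhs n                                            ∎
    where
    term : ℕ → ℕ → Carrier
    term m k = pow (- q) (m ∸ k) * SBo m k

    v u : ℕ → Carrier
    v k = pow (- q) (n ∸ k) * (qdfact (2 N.* suc k) * SB n k)
    u k = pow (- q) (suc n ∸ k) * (qdfact (2 N.* k) * (qnum (2 N.* k N.+ 1) * SB n k))

    term-suc : ∀ k → term (suc n) (suc k) ≈ v k + u (suc k)
    term-suc k = trans (*-congˡ (distribˡ _ _ _)) (distribˡ _ _ _)

    u[n+1]≈0 : u (suc n) ≈ 0#
    u[n+1]≈0 = trans (*-congˡ (*-congˡ (trans (*-congˡ (SB-above-diagonal {n} NP.≤-refl)) (zeroʳ _))))
                 (trans (*-congˡ (zeroʳ _)) (zeroʳ _))

    v+u≈term : ∀ k → k N.≤ n → v k + u k ≈ term n k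
    -- After rewriting (-q)^(n+1-k) to (-q)(-q)^(n-k), the semiring solver sees
    -- -q as an independent variable; q + -q = 0 is then applied by hand.
    v+u≈term k k≤n rewrite NP.+-∸-assoc 1 k≤n = begin
      p * (qdfact (2 N.* suc k) * s) + - q * p * (d * (r * s)) ≈⟨ +-congʳ (*-congˡ (*-congʳ (qdfact-double-suc k))) ⟩
      p * ((1# + q * r) * d * s) + - q * p * (d * (r * s))    ≈⟨ solve 6 (λ x m p d r s →
                                                                     p :* ((con 1 :+ x :* r) :* d :* s) :+ m :* p :* (d :* (r :* s))
                                                                     := p :* (d :* s) :+ (x :* (p :* (d :* (r :* s))) :+ m :* (p :* (d :* (r :* s)))))
                                                                   refl q (- q) p d r s ⟩
      p * (d * s) + (q * y + - q * y)                          ≈⟨ +-congˡ (trans (sym (distribʳ y q (- q))) (*-congʳ (-‿inverseʳ q))) ⟩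
      p * (d * s) + 0# * y                                     ≈⟨ trans (+-congˡ (zeroˡ y)) (+-identityʳ _) ⟩
      p * (d * s)                                              ∎
      where
      p d r s y : Carrier
      p = pow (- q) (n ∸ k)
      d = qdfact (2 N.* k)
      r = qnum (2 N.* k N.+ 1)
      s = SB n k
      y = p * (d * (r * s))

  lhs≈1 : ∀ n → lhs n ≈ 1#
  lhs≈1 zero    = trans (*-identityˡ _) (*-identityˡ _)
  lhs≈1 (suc n) = trans (lhs-suc n) (lhs≈1 n)

theorem5p9 : ∀ {c ℓ} (R : CommutativeRing c ℓ) (q : CommutativeRing.Carrier R) (n : ℕ) →
    CommutativeRing._≈_ R (QDefs.lhs R q n) (CommutativeRing.1# R)
theorem5p9 R q n = lhs≈1 R q n
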